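{- Assume the law of excluded middle. Every bounded element of $\mathrm{ord}$ is finite: if $\alpha\in\mathrm{ord}$ satisfies $\alpha\le\underline m$ for some $m\in\mathbb N$, then $\alpha=_{\mathrm{Ord}}\underline n$ for some $n\in\mathbb N$.
   Context: Let $\mathfrak F$ be a set of index sets containing $\mathbb N$ and every $\mathbb N_k=\{n\in\mathbb N:n<k\}$, closed (up to isomorphism) under finitely enumerated subsets, sets of finitely enumerated subsets, and disjoint unions indexed by elements of $\mathfrak F$. The set $\mathrm{ord}=\mathrm{ord}_{\mathfrak F}$ is defined inductively: a distinguished element $\underline 0$, and for every $I\in\mathfrak F$ and family $(\alpha_i)_{i\in I}$ in $\mathrm{ord}$ an element $\mathrm S(\alpha_i)_{i\in I}$. For $\alpha=\mathrm S(\alpha_i)_{i\in I}$, $\mathrm{In}_\alpha=I$; by convention $\mathrm{In}_{\underline0}=\emptyset$. For a finite list $F\subseteq_f\mathrm{In}_\alpha$, $\alpha_F$ is the list of the $\alpha_i$, $i\in F$. By simultaneous induction ($m\ge1$): $\alpha\le\beta^1,\dots,\beta^m$ means $\alpha_i<\beta^1,\dots,\beta^m$ for all $i\in\mathrm{In}_\alpha$; $\alpha<\beta^1,\dots,\beta^m$ means there exist finite lists $F_k\subseteq_f\mathrm{In}_{\beta^k}$, not all empty, with $\alpha\le\beta^1_{F_1},\dots,\beta^m_{F_m}$; $m=1$ gives binary $\le,<$. $\alpha=_{\mathrm{Ord}}\beta$ means $\alpha\le\beta$ and $\beta\le\alpha$. $\mathrm{suc}(\gamma)=\mathrm S(\beta_i)_{i\in\mathbb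 N_1}$ with $\beta_0=\gamma$, and $\underline{n+1}=\mathrm{suc}(\underline n)$. -}

module Defs where

open import Data.Nat using (ℕ; zero; suc)
open import Data.Fin using (Fin)
open import Data.List using (List; []; _∷_; map; _++_)
open import Data.List.Membership.Propositional using (_∈_)
open import Data.Product using (Σ; _×_)
open import Data.Unit using (⊤)
open import Data.Empty using (⊥)
open import Data.Sum using (_⊎_)
open import Relation.Nullary using (¬_)
open import Function.Bundles using (_↔_)

LEM : Set₁
LEM = (P : Set) → P ⊎ ¬ P

-- A set 𝔉 of index sets, given as codes U with decoding El,
-- containing ℕ and every ℕ_k, and closed up to isomorphism under
-- finitely enumerated subsets, sets of finitely enumerated subsets,
-- and disjoint unions indexed by elements of 𝔉.
record IndexFamily : Set₁ where
  field
    U   : Set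
    El  : U → Set
    ℕ-code  : U
    ℕ-iso   : El ℕ-code ↔ ℕ
    Fin-code : ℕ → U
    Fin-iso  : ∀ k → El (Fin-code k) ↔ Fin k
    sub-code : (I : U) → List (El I) → U
    sub-iso  : ∀ I l → El (sub-code I l) ↔ Σ (El I) (λ i → i ∈ l)
    fin-subsets-code : U → U
    fin-subsets-iso  : ∀ I → El (fin-subsets-code I) ↔ List (El I)
    Σ-code : (I : U) → (El I → U) → U
    Σ-iso  : ∀ I J → El (Σ-code I J) ↔ Σ (El I) (λ i → El (J i))

module Ord (𝔉 : IndexFamily) where
  open IndexFamily 𝔉

  data ord : Set where
    𝟘 : ord
    S : {I : U} → (El I → ord) → ord

  In : ord → Set
  In 𝟘 = ⊥
  In (S {I} f) = El I

  component : (α : ord) → In α → ord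
  component (S f) i = f i

  sub : (α : ord) → List (In α) → List ord
  sub α F = map (component α) F

  data Choice : List ord → Set where
    []  : Choice []
    _∷_ : {β : ord} {βs : List ord} → List (In β) → Choice βs → Choice (β ∷ βs)

  NotAllEmpty : {βs : List ord} → Choice βs → Set
  NotAllEmpty [] = ⊥
  NotAllEmpty ([] ∷ Fs) = NotAllEmpty Fs
  NotAllEmpty ((_ ∷ _) ∷ Fs) = ⊤

  flatten : {βs : List ord} → Choice βs → List ord
  flatten {[]} [] = []
  flatten {β ∷ βs} (F ∷ Fs) = sub β F ++ flatten Fs

  _<ˢ_ : ord → List ord → Set
  _≤ˢ_ : ord → List ord → Set
  α <ˢ βs = Σ (Choice βs) (λ Fs → NotAllEmpty Fs × (α ≤ˢ flatten Fs))
  𝟘 ≤ˢ βs = ⊤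
  S f ≤ˢ βs = ∀ i → f i <ˢ βs

  _≤_ : ord → ord → Set
  α ≤ β = α ≤ˢ (β ∷ [])

  _<_ : ord → ord → Set
  α < β = α <ˢ (β ∷ [])

  _=Ord_ : ord → ord → Set
  α =Ord β = (α ≤ β) × (β ≤ α)

  sucO : ord → ord
  sucO γ = S {Fin-code 1} (λ _ → γ)

  num : ℕ → ord
  num zero = 𝟘
  num (suc n) = sucO (num n)

{-# OPTIONS --safe #-}
-- Call α of depth ≤ k when every descending path α, α_i, α_{i i'}, … of
-- components has at most k steps.  Unfolding α ≤ m along the single
-- component of each successor shows that α has depth ≤ m, and depth ≤ n
-- gives α ≤ n.  By excluded middle, an α of depth ≤ n+1 either has a
-- component α_i with n ≤ α_i, so that n+1 ≤ α, or, by induction on n, all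
-- its components have depth ≤ n-1, so that α has depth ≤ n; descending
-- from n = m reaches an n with both α ≤ n and n ≤ α.
module Submission where

open import Defs
open import Data.Nat using (ℕ; zero; suc)
open import Data.Product using (Σ; _,_; _×_)
open import Data.List using ([]; _∷_)
open import Data.List.Relation.Unary.All using (All; []; _∷_; universal)
open import Data.List.Relation.Unary.All.Properties using (++⁺; map⁺)
open import Data.Unit using (tt)
open import Data.Empty using (⊥-elim)
open import Data.Sum using (_⊎_; inj₁; inj₂; [_,_])
open import Function using (id)
open import Function.Bundles using (Inverse)
open import Relation.Binary.PropositionalEquality using (_≡_; refl)
open import Relation.Nullary using (¬_)
import Data.Fin as Fin

module _ (𝔉 : IndexFamily) where
  open IndexFamily 𝔉
  open Ord 𝔉

  Depth≤ : ℕ → ord → Set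
  Depth≤ zero    α = ¬ In α
  Depth≤ (suc k) α = (i : In α) → Depth≤ k (component α i)

  depth≤-𝟘 : ∀ k → Depth≤ k 𝟘
  depth≤-𝟘 zero    = λ ()
  depth≤-𝟘 (suc k) = λ ()

  ≤⇒<sucO : ∀ {α γ} → α ≤ γ → α < sucO γ
  ≤⇒<sucO α≤γ = ((Inverse.from (Fin-iso 1) Fin.zero ∷ []) ∷ []) , tt , α≤γ

  sucO-≤-S : ∀ {γ I} {f : El I → ord} (i : El I) → γ ≤ f i → sucO γ ≤ S f
  sucO-≤-S i γ≤fi = λ _ → ((i ∷ []) ∷ []) , tt , γ≤fi

  depth≤⇒≤num : ∀ k α → Depth≤ k α → α ≤ num k
  depth≤⇒≤num _       𝟘     _ = tt
  depth≤⇒≤num zero    (S f) d = λ i → ⊥-elim (d i)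
  depth≤⇒≤num (suc k) (S f) d = λ i → ≤⇒<sucO (depth≤⇒≤num k (f i) (d i))

  choice-𝟘-allEmpty : ∀ {βs} → All (_≡ 𝟘) βs → (Fs : Choice βs) → ¬ NotAllEmpty Fs
  choice-𝟘-allEmpty (refl ∷ βs≡𝟘) ([] ∷ Fs) = choice-𝟘-allEmpty βs≡𝟘 Fs

  flatten-sucO : ∀ {γ βs} → All (_≡ sucO γ) βs → (Fs : Choice βs) → All (_≡ γ) (flatten Fs)
  flatten-sucO []               []       = []
  flatten-sucO (refl ∷ βs≡sucγ) (F ∷ Fs) =
    ++⁺ (map⁺ (universal (λ _ → refl) F)) (flatten-sucO βs≡sucγ Fs)

  ≤ˢ-num⇒depth≤ : ∀ m α {βs} → All (_≡ num m) βs → α ≤ˢ βs → Depth≤ m α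
  ≤ˢ-num⇒depth≤ m       𝟘     _      _   = depth≤-𝟘 m
  ≤ˢ-num⇒depth≤ zero    (S f) βs≡m α≤βs i
    with Fs , notAllEmpty , _ ← α≤βs i = choice-𝟘-allEmpty βs≡m Fs notAllEmpty
  ≤ˢ-num⇒depth≤ (suc m) (S f) βs≡m α≤βs i
    with Fs , _ , fi≤Fs ← α≤βs i = ≤ˢ-num⇒depth≤ m (f i) (flatten-sucO βs≡m Fs) fi≤Fs

  ≤num⇒depth≤ : ∀ m α → α ≤ num m → Depth≤ m α
  ≤num⇒depth≤ m α = ≤ˢ-num⇒depth≤ m α (refl ∷ [])

  depth≤-suc-split : LEM → ∀ j β → Depth≤ (suc j) β → Depth≤ j β ⊎ num (suc j) ≤ β
  depth≤-suc-split lem j       𝟘         _ = inj₁ (depth≤-𝟘 j)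
  depth≤-suc-split lem zero    (S {I} f) _ with lem (El I)
  ... | inj₁ i     = inj₂ (sucO-≤-S i tt)
  ... | inj₂ empty = inj₁ empty
  depth≤-suc-split lem (suc j) (S {I} f) d with lem (Σ (El I) λ i → num (suc j) ≤ f i)
  ... | inj₁ (i , sucj≤fi) = inj₂ (sucO-≤-S i sucj≤fi)
  ... | inj₂ noneAbove     = inj₁ λ i →
        [ id , (λ sucj≤fi → ⊥-elim (noneAbove (i , sucj≤fi))) ] (depth≤-suc-split lem j (f i) (d i))

  exact-depth : LEM → ∀ m α → Depth≤ m α → Σ ℕ λ n → Depth≤ n α × num n ≤ α
  exact-depth lem zero    α d = zero , d , tt
  exact-depth lem (suc m) α d with depth≤-suc-split lem m α d
  ... | inj₁ d′     = exact-depth lem m α d′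
  ... | inj₂ sucm≤α = suc m , d , sucm≤α

corollary3p21 : (𝔉 : IndexFamily) → LEM → let open Ord 𝔉 in
    (α : ord) (m : ℕ) → α ≤ num m → Σ ℕ (λ n → α =Ord num n)
corollary3p21 𝔉 lem α m α≤m
  with n , d , n≤α ← exact-depth 𝔉 lem m α (≤num⇒depth≤ 𝔉 m α α≤m) =
  n , depth≤⇒≤num 𝔉 n α d , n≤α
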